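{- For $i,j\ge 0$ let $c^{(2)}_{i,j}$ be the number of standard paths whose final composition has exactly $i$ parts equal to $1$, exactly $j$ parts equal to $2$, and no other parts. For $k\ge 0$ put $P_k(x)=\sum_{n\ge 0}c^{(2)}_{n,k}x^n$. Then $P_0(x)=(1-x)^{ -1}$ and for every $k\ge 1$ \[ P_k(x)=\frac{\frac{d}{dx}P_{k-1}(x)}{1-2x}. \]
   Context: A composition is a finite sequence $P=(p_1,\dots,p_k)$ of positive integers (its parts); the empty composition $()$ is allowed, and the weight of $P$ is $p_1+\cdots+p_k$. $Q$ covers $P=(p_1,\dots,p_k)$ if $Q$ is one of $(1,p_1,\dots,p_k)$, $(p_1,\dots,p_k,1)$, or $(p_1,\dots,p_i+1,\dots,p_k)$ for some $1\le i\le k$. A standard path of length $n$ is a sequence $(P_0,P_1,\dots,P_n)$ of compositions with $P_i$ of weight $i$ and $P_{i+1}$ covering $P_i$ for each $i$; its final composition is $P_n$. Standard paths are distinct iff they differ as sequences of compositions. Power series are formal. -}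

module Defs where

open import Data.Nat using (ℕ; zero; suc; _+_; _*_; _∸_; _^_; _≡ᵇ_)
open import Data.Nat.Properties using () renaming (_≟_ to _≟ℕ_)
open import Data.Bool using (Bool; true; false; _∧_; _∨_)
open import Data.List.Base using (List; []; _∷_; _++_; [_]; map; concatMap; length; filterᵇ; deduplicate; all; upTo)
open import Data.Nat.ListAction using (sum)
open import Data.List.Properties using (≡-dec)

-- A composition is a list of positive integers (positivity is automatic for
-- every composition reachable from the empty one by covering steps).
Composition : Set
Composition = List ℕ

_≟C_ = ≡-dec _≟ℕ_

increments : Composition → List Composition
increments []       = []
increments (p ∷ ps) = (suc p ∷ ps) ∷ map (p ∷_) (increments ps)

covers : Composition → List Composition
covers P = deduplicate _≟C_ ((1 ∷ P) ∷ (P ++ [ 1 ]) ∷ increments P)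

-- A standard path (P_0 , ... , P_n) is stored REVERSED as the list
-- P_n ∷ P_{n-1} ∷ ... ∷ P_0 ∷ [], so its head is the final composition.
-- standardPaths n lists every standard path of length n exactly once.
standardPaths : ℕ → List (List Composition)
standardPaths zero    = ([] ∷ []) ∷ []
standardPaths (suc n) = concatMap extend (standardPaths n)
  where
  extend : List Composition → List (List Composition)
  extend []         = []
  extend (P ∷ rest) = map (λ Q → Q ∷ P ∷ rest) (covers P)

finalComposition : List Composition → Composition
finalComposition []      = []
finalComposition (P ∷ _) = P

countPart : ℕ → Composition → ℕ
countPart a []       = 0
countPart a (p ∷ ps) with p ≡ᵇ a
... | true  = suc (countPart a ps)
... | false = countPart a ps

hasShape : ℕ → ℕ → Composition → Bool
hasShape i j P = all (λ p → (p ≡ᵇ 1) ∨ (p ≡ᵇ 2)) P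
               ∧ (countPart 1 P ≡ᵇ i) ∧ (countPart 2 P ≡ᵇ j)

-- c^{(2)}_{i,j}: such a final composition has weight i + 2j, so every
-- standard path ending in it has length i + 2j.
c2 : ℕ → ℕ → ℕ
c2 i j = length (filterᵇ (λ π → hasShape i j (finalComposition π))
                         (standardPaths (i + 2 * j)))

-- Formal power series with natural-number coefficients: coefficient functions.
Series : Set
Series = ℕ → ℕ

Pser : ℕ → Series
Pser k n = c2 n k

deriv : Series → Series
deriv f n = suc n * f (suc n)

_⊛_ : Series → Series → Series
(f ⊛ g) n = sum (map (λ i → f i * g (n ∸ i)) (upTo (suc n)))

-- (1 - a x)^{-1} = Σ_n a^n x^n
invOneMinus : ℕ → Series
invOneMinus a n = a ^ n

{-# OPTIONS --safe #-}
-- Write c2 i j as a sum, over the standard paths of length i + 2j, of the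
-- indicator χ i j of the shape of the final composition.  Dropping the last
-- step turns a sum over paths of length n + 1 into a sum over paths of length n
-- weighted by the local sums Σ_{Q covers P} χ i j Q.  These are computed
-- directly: prepending and appending a 1 give two covers of the same shape,
-- which coincide exactly when P consists of 1s, and incrementing one of the
-- i + 1 ones of a composition of shape (i + 1, j) gives shape (i, j + 1).
-- Hence c2 (n + 1) 0 = c2 n 0, c2 0 (j + 1) = c2 1 j and
--   c2 (i + 1) (j + 1) = 2 c2 i (j + 1) + (i + 2) c2 (i + 2) j,
-- i.e. P_{k+1} = 2x P_{k+1} + P_k′, whose solution is P_k′ / (1 - 2x).
module Submission where

open import Defs
open import Data.Bool.Base using (Bool; true; false; _∧_; _∨_; if_then_else_)
open import Data.Bool.Properties using (∧-zeroʳ)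
open import Data.Empty using (⊥)
open import Data.List.Base
  using (List; []; _∷_; _++_; [_]; map; concatMap; length; filter; filterᵇ; deduplicate; all; applyUpTo; upTo)
open import Data.List.Properties
  using (map-∘; map-++; map-cong-local; map-applyUpTo; filter-all; filter-accept; filter-reject; ∷-injective; ∷-injectiveˡ; ∷-injectiveʳ; length-++)
open import Data.List.Relation.Unary.All using (All; []; _∷_)
import Data.List.Relation.Unary.All as All
import Data.List.Relation.Unary.All.Properties as All
open import Data.List.Relation.Unary.AllPairs using ([]; _∷_)
open import Data.List.Relation.Unary.Unique.Propositional using (Unique)
import Data.List.Relation.Unary.Unique.Propositional.Properties as Unique
open import Data.Nat.Base using (ℕ; zero; suc; _+_; _*_; _∸_; _^_; _<_; _≡ᵇ_; z≤n; s≤s)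
open import Data.Nat.ListAction using (sum)
open import Data.Nat.ListAction.Properties using (sum-++)
open import Data.Nat.Properties using (+-comm; +-identityʳ; *-identityˡ; *-identityʳ; *-zeroʳ; ^-zeroˡ; 1+n≢n)
open import Data.Nat.Tactic.RingSolver using (solve-∀)
open import Data.Product.Base using (_×_; _,_)
open import Function.Base using (_∘_)
open import Relation.Binary.Definitions using (DecidableEquality)
open import Relation.Binary.PropositionalEquality
  using (_≡_; _≢_; refl; sym; trans; cong; cong₂; module ≡-Reasoning)
open import Relation.Nullary using (¬?; contradiction)
open import Relation.Nullary.Decidable using (toSum)
open import Data.Sum.Base using (inj₁; inj₂)

open ≡-Reasoning

length-filterᵇ : ∀ {A : Set} (p : A → Bool) (xs : List A) →
                 length (filterᵇ p xs) ≡ sum (map (λ x → if p x then 1 else 0) xs)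
length-filterᵇ p []       = refl
length-filterᵇ p (x ∷ xs) with p x
... | true  = cong suc (length-filterᵇ p xs)
... | false = length-filterᵇ p xs

sum-map-concatMap : ∀ {A B : Set} (f : B → ℕ) (g : A → List B) (xs : List A) →
                    sum (map f (concatMap g xs)) ≡ sum (map (λ x → sum (map f (g x))) xs)
sum-map-concatMap f g []       = refl
sum-map-concatMap f g (x ∷ xs) = begin
  sum (map f (g x ++ concatMap g xs))                ≡⟨ cong sum (map-++ f (g x) _) ⟩
  sum (map f (g x) ++ map f (concatMap g xs))        ≡⟨ sum-++ (map f (g x)) _ ⟩
  sum (map f (g x)) + sum (map f (concatMap g xs))   ≡⟨ cong (sum (map f (g x)) +_) (sum-map-concatMap f g xs) ⟩
  sum (map f (g x)) + sum (map (λ y → sum (map f (g y))) xs) ∎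

sum-map-≡0 : ∀ {A : Set} {f : A → ℕ} → (∀ x → f x ≡ 0) → (xs : List A) → sum (map f xs) ≡ 0
sum-map-≡0 f≡0 []       = refl
sum-map-≡0 f≡0 (x ∷ xs) = cong₂ _+_ (f≡0 x) (sum-map-≡0 f≡0 xs)

sum-map-linear : ∀ {A : Set} (a b : ℕ) (f g : A → ℕ) (xs : List A) →
                 sum (map (λ x → a * f x + b * g x) xs) ≡ a * sum (map f xs) + b * sum (map g xs)
sum-map-linear a b f g []       = cong₂ _+_ (sym (*-zeroʳ a)) (sym (*-zeroʳ b))
sum-map-linear a b f g (x ∷ xs) = begin
  a * f x + b * g x + sum (map (λ y → a * f y + b * g y) xs)
    ≡⟨ cong (a * f x + b * g x +_) (sum-map-linear a b f g xs) ⟩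
  a * f x + b * g x + (a * sum (map f xs) + b * sum (map g xs))
    ≡⟨ regroup a b (f x) (g x) (sum (map f xs)) (sum (map g xs)) ⟩
  a * (f x + sum (map f xs)) + b * (g x + sum (map g xs)) ∎
  where
  regroup : ∀ a b u v s t → a * u + b * v + (a * s + b * t) ≡ a * (u + s) + b * (v + t)
  regroup = solve-∀

deduplicate-unique : ∀ {A : Set} (_≟_ : DecidableEquality A) {xs : List A} →
                     Unique xs → deduplicate _≟_ xs ≡ xs
deduplicate-unique _≟_ []                       = refl
deduplicate-unique _≟_ {x ∷ xs} (x∉xs ∷ unique) = begin
  x ∷ filter (¬? ∘ (x ≟_)) (deduplicate _≟_ xs) ≡⟨ cong (λ ys → x ∷ filter (¬? ∘ (x ≟_)) ys) (deduplicate-unique _≟_ unique) ⟩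
  x ∷ filter (¬? ∘ (x ≟_)) xs                   ≡⟨ cong (x ∷_) (filter-all (¬? ∘ (x ≟_)) x∉xs) ⟩
  x ∷ xs                                        ∎

χ : ℕ → ℕ → Composition → ℕ
χ i j P = if hasShape i j P then 1 else 0

χ-0-1∷ : ∀ j P → χ 0 j (1 ∷ P) ≡ 0
χ-0-1∷ j P = cong (λ b → if b then 1 else 0) (∧-zeroʳ (all _ P))

χ-0-2∷ : ∀ i P → χ i 0 (2 ∷ P) ≡ 0
χ-0-2∷ i P rewrite ∧-zeroʳ (countPart 1 P ≡ᵇ i) =
  cong (λ b → if b then 1 else 0) (∧-zeroʳ (all _ P))

χ-no-2s : ∀ i j P → countPart 2 P ≡ 0 → χ i (suc j) P ≡ 0
χ-no-2s i j P no-2s rewrite no-2s | ∧-zeroʳ (countPart 1 P ≡ᵇ i) =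
  cong (λ b → if b then 1 else 0) (∧-zeroʳ (all _ P))

all-∷ʳ : ∀ (f : ℕ → Bool) b P → all f (P ++ [ b ]) ≡ all f (b ∷ P)
all-∷ʳ f b []       = refl
all-∷ʳ f b (p ∷ ps) rewrite all-∷ʳ f b ps with f p | f b
... | true  | _     = refl
... | false | true  = refl
... | false | false = refl

countPart-∷ʳ : ∀ a b P → countPart a (P ++ [ b ]) ≡ countPart a (b ∷ P)
countPart-∷ʳ a b []       = refl
countPart-∷ʳ a b (p ∷ ps) with b ≡ᵇ a | countPart-∷ʳ a b ps
... | true  | ih with p ≡ᵇ a
...   | true  = cong suc ih
...   | false = ih
countPart-∷ʳ a b (p ∷ ps) | false | ih with p ≡ᵇ a
...   | true  = cong suc ih
...   | false = ih

χ-∷ʳ : ∀ i j b P → χ i j (P ++ [ b ]) ≡ χ i j (b ∷ P)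
χ-∷ʳ i j b P rewrite all-∷ʳ (λ p → (p ≡ᵇ 1) ∨ (p ≡ᵇ 2)) b P
                   | countPart-∷ʳ 1 b P | countPart-∷ʳ 2 b P = refl

-- Defs does not force parts to be positive, but incrementing a part 0 would
-- create a new part 1, so positivity is carried along the paths.
Positive : Composition → Set
Positive = All (0 <_)

sum-map-increments-∷ : ∀ (w : Composition → ℕ) p ps →
  sum (map w (increments (p ∷ ps))) ≡ w (suc p ∷ ps) + sum (map (w ∘ (p ∷_)) (increments ps))
sum-map-increments-∷ w p ps = cong (λ xs → w (suc p ∷ ps) + sum xs) (sym (map-∘ (increments ps)))

sum-χ-increments-0 : ∀ i P → Positive P → sum (map (χ i 0) (increments P)) ≡ 0
sum-χ-increments-0 i []       _ = refl
sum-χ-increments-0 i (p ∷ ps) (p>0 ∷ ps>0) = trans (sum-map-increments-∷ (χ i 0) p ps) (rest i p p>0)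
  where
  rest : ∀ i p → 0 < p → χ i 0 (suc p ∷ ps) + sum (map (χ i 0 ∘ (p ∷_)) (increments ps)) ≡ 0
  rest zero    1 _ = cong₂ _+_ (χ-0-2∷ 0 ps) (sum-map-≡0 (χ-0-1∷ 0) (increments ps))
  rest (suc i) 1 _ = cong₂ _+_ (χ-0-2∷ (suc i) ps) (sum-χ-increments-0 i ps ps>0)
  rest i       2 _ = sum-map-≡0 (χ-0-2∷ i) (increments ps)
  rest i (suc (suc (suc p))) _ = sum-map-≡0 (λ _ → refl) (increments ps)

sum-χ-increments : ∀ i j P → Positive P →
                   sum (map (χ i (suc j)) (increments P)) ≡ suc i * χ (suc i) j P
sum-χ-increments i j []       _ = sym (*-zeroʳ (suc i))
sum-χ-increments i j (p ∷ ps) (p>0 ∷ ps>0) = trans (sum-map-increments-∷ (χ i (suc j)) p ps) (split i j p p>0)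
  where
  split : ∀ i j p → 0 < p →
          χ i (suc j) (suc p ∷ ps) + sum (map (χ i (suc j) ∘ (p ∷_)) (increments ps)) ≡ suc i * χ (suc i) j (p ∷ ps)
  split zero    j 1 _ = cong (χ 0 j ps +_) (sum-map-≡0 (χ-0-1∷ (suc j)) (increments ps))
  split (suc i) j 1 _ = cong (χ (suc i) j ps +_) (sum-χ-increments i j ps ps>0)
  split i zero    2 _ = trans (sum-χ-increments-0 i ps ps>0)
                              (sym (trans (cong (suc i *_) (χ-0-2∷ (suc i) ps)) (*-zeroʳ (suc i))))
  split i (suc j) 2 _ = sum-χ-increments i j ps ps>0
  split i j (suc (suc (suc p))) _ = trans (sum-map-≡0 (λ _ → refl) (increments ps)) (sym (*-zeroʳ (suc i)))

increments-positive : ∀ {P} → Positive P → All Positive (increments P)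
increments-positive []            = []
increments-positive (p>0 ∷ ps>0) =
  (s≤s z≤n ∷ ps>0) ∷ All.map⁺ (All.map (p>0 ∷_) (increments-positive ps>0))

increments-unique : ∀ P → Unique (increments P)
increments-unique []       = []
increments-unique (p ∷ ps) =
  All.map⁺ (All.universal (λ Q eq → 1+n≢n (∷-injectiveˡ eq)) (increments ps))
  ∷ Unique.map⁺ ∷-injectiveʳ (increments-unique ps)

increments-length : ∀ P → All (λ Q → length Q ≡ length P) (increments P)
increments-length []       = []
increments-length (p ∷ ps) = refl ∷ All.map⁺ (All.map (cong suc) (increments-length ps))

longer-∉-increments : ∀ {Q} P → length Q ≡ suc (length P) → All (Q ≢_) (increments P)
longer-∉-increments P |Q|≡1+|P| = All.map
  (λ |R|≡|P| Q≡R → 1+n≢n (trans (sym |Q|≡1+|P|) (trans (cong length Q≡R) |R|≡|P|)))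
  (increments-length P)

covers-positive : ∀ {P} → Positive P → All Positive (covers P)
covers-positive P>0 = All.deduplicate⁺ _≟C_
  ((s≤s z≤n ∷ P>0) ∷ All.++⁺ P>0 (s≤s z≤n ∷ []) ∷ increments-positive P>0)

-- The increments are pairwise distinct and shorter than 1 ∷ P and P ++ [ 1 ],
-- so deduplication can only identify those two.
covers-unfold : ∀ P → covers P ≡ (1 ∷ P) ∷ filter (¬? ∘ ((1 ∷ P) ≟C_)) ((P ++ [ 1 ]) ∷ increments P)
covers-unfold P = cong (λ I → (1 ∷ P) ∷ filter (¬? ∘ ((1 ∷ P) ≟C_)) ((P ++ [ 1 ]) ∷ I)) (begin
  filter (¬? ∘ ((P ++ [ 1 ]) ≟C_)) (deduplicate _≟C_ (increments P))
    ≡⟨ cong (filter _) (deduplicate-unique _≟C_ (increments-unique P)) ⟩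
  filter (¬? ∘ ((P ++ [ 1 ]) ≟C_)) (increments P)
    ≡⟨ filter-all _ (longer-∉-increments P (trans (length-++ P) (+-comm (length P) 1))) ⟩
  increments P ∎)

covers-if-1∷P≡P++[1] : ∀ {P} → 1 ∷ P ≡ P ++ [ 1 ] → covers P ≡ (1 ∷ P) ∷ increments P
covers-if-1∷P≡P++[1] {P} eq = trans (covers-unfold P) (cong ((1 ∷ P) ∷_)
  (trans (filter-reject A≢? (λ ne → ne eq)) (filter-all A≢? (longer-∉-increments P refl))))
  where A≢? = ¬? ∘ ((1 ∷ P) ≟C_)

covers-if-1∷P≢P++[1] : ∀ {P} → 1 ∷ P ≢ P ++ [ 1 ] →
                       covers P ≡ (1 ∷ P) ∷ (P ++ [ 1 ]) ∷ increments P
covers-if-1∷P≢P++[1] {P} ne = trans (covers-unfold P) (cong ((1 ∷ P) ∷_)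
  (trans (filter-accept A≢? ne) (cong ((P ++ [ 1 ]) ∷_) (filter-all A≢? (longer-∉-increments P refl)))))
  where A≢? = ¬? ∘ ((1 ∷ P) ≟C_)

sum-χ-covers-if-1∷P≡P++[1] : ∀ i j {P} → 1 ∷ P ≡ P ++ [ 1 ] →
  sum (map (χ i j) (covers P)) ≡ χ i j (1 ∷ P) + sum (map (χ i j) (increments P))
sum-χ-covers-if-1∷P≡P++[1] i j eq = cong (sum ∘ map (χ i j)) (covers-if-1∷P≡P++[1] eq)

sum-χ-covers-if-1∷P≢P++[1] : ∀ i j {P} → 1 ∷ P ≢ P ++ [ 1 ] →
  sum (map (χ i j) (covers P)) ≡ 2 * χ i j (1 ∷ P) + sum (map (χ i j) (increments P))
sum-χ-covers-if-1∷P≢P++[1] i j {P} ne = begin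
  sum (map (χ i j) (covers P))
    ≡⟨ cong (sum ∘ map (χ i j)) (covers-if-1∷P≢P++[1] ne) ⟩
  χ i j (1 ∷ P) + (χ i j (P ++ [ 1 ]) + Σincrements)
    ≡⟨ cong (λ x → χ i j (1 ∷ P) + (x + Σincrements)) (χ-∷ʳ i j 1 P) ⟩
  χ i j (1 ∷ P) + (χ i j (1 ∷ P) + Σincrements)
    ≡⟨ double (χ i j (1 ∷ P)) Σincrements ⟩
  2 * χ i j (1 ∷ P) + Σincrements ∎
  where
  Σincrements = sum (map (χ i j) (increments P))
  double : ∀ x s → x + (x + s) ≡ 2 * x + s
  double = solve-∀

1∷P≡P++[1]⇒no-2s : ∀ P → 1 ∷ P ≡ P ++ [ 1 ] → countPart 2 P ≡ 0
1∷P≡P++[1]⇒no-2s []       _  = refl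
1∷P≡P++[1]⇒no-2s (p ∷ ps) eq with ∷-injective eq
... | refl , eq′ = 1∷P≡P++[1]⇒no-2s ps eq′

1∷P≢P++[1]⇒χ-0≡0 : ∀ i P → 1 ∷ P ≢ P ++ [ 1 ] → χ i 0 P ≡ 0
1∷P≢P++[1]⇒χ-0≡0 i       []                  ne = contradiction refl ne
1∷P≢P++[1]⇒χ-0≡0 i       (0 ∷ ps)            ne = refl
1∷P≢P++[1]⇒χ-0≡0 zero    (1 ∷ ps)            ne = χ-0-1∷ 0 ps
1∷P≢P++[1]⇒χ-0≡0 (suc i) (1 ∷ ps)            ne = 1∷P≢P++[1]⇒χ-0≡0 i ps (ne ∘ cong (1 ∷_))
1∷P≢P++[1]⇒χ-0≡0 i       (2 ∷ ps)            ne = χ-0-2∷ i ps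
1∷P≢P++[1]⇒χ-0≡0 i       (suc (suc (suc p)) ∷ ps) ne = refl

-- Matching on `toSum` rather than on the decision itself stops `with` from
-- abstracting the decision where it occurs inside the unfolding of `covers P`.
sum-χ-covers-0 : ∀ i P → Positive P → sum (map (χ (suc i) 0) (covers P)) ≡ χ i 0 P
sum-χ-covers-0 i P P>0 with toSum ((1 ∷ P) ≟C (P ++ [ 1 ]))
... | inj₁ eq = begin
  sum (map (χ (suc i) 0) (covers P))                    ≡⟨ sum-χ-covers-if-1∷P≡P++[1] (suc i) 0 eq ⟩
  χ i 0 P + sum (map (χ (suc i) 0) (increments P))      ≡⟨ cong (χ i 0 P +_) (sum-χ-increments-0 (suc i) P P>0) ⟩
  χ i 0 P + 0                                           ≡⟨ +-identityʳ _ ⟩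
  χ i 0 P                                               ∎
... | inj₂ ne = begin
  sum (map (χ (suc i) 0) (covers P))                    ≡⟨ sum-χ-covers-if-1∷P≢P++[1] (suc i) 0 ne ⟩
  2 * χ i 0 P + sum (map (χ (suc i) 0) (increments P))  ≡⟨ cong₂ (λ x s → 2 * x + s) χ≡0 (sum-χ-increments-0 (suc i) P P>0) ⟩
  0                                                     ≡⟨ sym χ≡0 ⟩
  χ i 0 P                                               ∎
  where χ≡0 = 1∷P≢P++[1]⇒χ-0≡0 i P ne

sum-χ-covers-suc : ∀ i j P → Positive P →
  sum (map (χ i (suc j)) (covers P)) ≡ 2 * χ i (suc j) (1 ∷ P) + suc i * χ (suc i) j P
sum-χ-covers-suc i j P P>0 with toSum ((1 ∷ P) ≟C (P ++ [ 1 ]))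
... | inj₁ eq = begin
  sum (map (χ i (suc j)) (covers P))                          ≡⟨ sum-χ-covers-if-1∷P≡P++[1] i (suc j) eq ⟩
  χ i (suc j) (1 ∷ P) + sum (map (χ i (suc j)) (increments P)) ≡⟨ cong₂ _+_ χ≡0 (sum-χ-increments i j P P>0) ⟩
  0 + suc i * χ (suc i) j P                                   ≡⟨ cong (λ x → 2 * x + suc i * χ (suc i) j P) (sym χ≡0) ⟩
  2 * χ i (suc j) (1 ∷ P) + suc i * χ (suc i) j P             ∎
  where χ≡0 = χ-no-2s i j (1 ∷ P) (1∷P≡P++[1]⇒no-2s P eq)
... | inj₂ ne = trans (sum-χ-covers-if-1∷P≢P++[1] i (suc j) ne)
                    (cong (2 * χ i (suc j) (1 ∷ P) +_) (sum-χ-increments i j P P>0))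

EndsPositive : List Composition → Set
EndsPositive []      = ⊥
EndsPositive (P ∷ _) = Positive P

standardPaths-endPositive : ∀ n → All EndsPositive (standardPaths n)
standardPaths-endPositive zero    = [] ∷ []
standardPaths-endPositive (suc n) = All.concat⁺ (All.map⁺ (All.map
  (λ { {P ∷ _} P>0 → All.map⁺ (covers-positive P>0) })
  (standardPaths-endPositive n)))

pathSum : ℕ → (Composition → ℕ) → ℕ
pathSum n w = sum (map (w ∘ finalComposition) (standardPaths n))

pathSum-suc : ∀ n {w v : Composition → ℕ} → (∀ P → Positive P → sum (map w (covers P)) ≡ v P) →
              pathSum (suc n) w ≡ pathSum n v
pathSum-suc n {w} local = trans
  (sum-map-concatMap (w ∘ finalComposition) _ (standardPaths n))
  (cong sum (map-cong-local (All.map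
    (λ { {P ∷ _} P>0 → trans (cong sum (sym (map-∘ (covers P)))) (local P P>0) })
    (standardPaths-endPositive n))))

pathSum-linear : ∀ n a b (f g : Composition → ℕ) →
                 pathSum n (λ P → a * f P + b * g P) ≡ a * pathSum n f + b * pathSum n g
pathSum-linear n a b f g = sum-map-linear a b (f ∘ finalComposition) (g ∘ finalComposition) (standardPaths n)

c2≡pathSum : ∀ {n} i j → i + 2 * j ≡ n → c2 i j ≡ pathSum n (χ i j)
c2≡pathSum i j refl = length-filterᵇ _ (standardPaths (i + 2 * j))

c2-suc-0 : ∀ i → c2 (suc i) 0 ≡ c2 i 0
c2-suc-0 i = begin
  c2 (suc i) 0                         ≡⟨ c2≡pathSum (suc i) 0 refl ⟩
  pathSum (suc (i + 0)) (χ (suc i) 0)  ≡⟨ pathSum-suc (i + 0) (sum-χ-covers-0 i) ⟩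
  pathSum (i + 0) (χ i 0)              ≡⟨ c2≡pathSum i 0 refl ⟨
  c2 i 0                               ∎

c2-0 : ∀ i → c2 i 0 ≡ 1
c2-0 zero    = refl
c2-0 (suc i) = trans (c2-suc-0 i) (c2-0 i)

c2-0-suc : ∀ j → c2 0 (suc j) ≡ c2 1 j
c2-0-suc j = begin
  c2 0 (suc j)                             ≡⟨ c2≡pathSum 0 (suc j) (weight j) ⟩
  pathSum (suc (1 + 2 * j)) (χ 0 (suc j))  ≡⟨ pathSum-suc (1 + 2 * j) local ⟩
  pathSum (1 + 2 * j) (χ 1 j)              ≡⟨ c2≡pathSum 1 j refl ⟨
  c2 1 j                                   ∎
  where
  weight : ∀ j → 2 * suc j ≡ suc (1 + 2 * j)
  weight = solve-∀
  local : ∀ P → Positive P → sum (map (χ 0 (suc j)) (covers P)) ≡ χ 1 j P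
  local P P>0 = begin
    sum (map (χ 0 (suc j)) (covers P))          ≡⟨ sum-χ-covers-suc 0 j P P>0 ⟩
    2 * χ 0 (suc j) (1 ∷ P) + 1 * χ 1 j P       ≡⟨ cong (λ x → 2 * x + 1 * χ 1 j P) (χ-0-1∷ (suc j) P) ⟩
    1 * χ 1 j P                                 ≡⟨ *-identityˡ (χ 1 j P) ⟩
    χ 1 j P                                     ∎

c2-suc-suc : ∀ i j → c2 (suc i) (suc j) ≡ 2 * c2 i (suc j) + suc (suc i) * c2 (suc (suc i)) j
c2-suc-suc i j = begin
  c2 (suc i) (suc j)
    ≡⟨ c2≡pathSum (suc i) (suc j) refl ⟩
  pathSum (suc n) (χ (suc i) (suc j))
    ≡⟨ pathSum-suc n (sum-χ-covers-suc (suc i) j) ⟩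
  pathSum n (λ P → 2 * χ i (suc j) P + suc (suc i) * χ (suc (suc i)) j P)
    ≡⟨ pathSum-linear n 2 (suc (suc i)) (χ i (suc j)) (χ (suc (suc i)) j) ⟩
  2 * pathSum n (χ i (suc j)) + suc (suc i) * pathSum n (χ (suc (suc i)) j)
    ≡⟨ cong₂ (λ x y → 2 * x + suc (suc i) * y) (c2≡pathSum i (suc j) refl) (c2≡pathSum (suc (suc i)) j (weight i j)) ⟨
  2 * c2 i (suc j) + suc (suc i) * c2 (suc (suc i)) j ∎
  where
  n = i + 2 * suc j
  weight : ∀ i j → suc (suc i) + 2 * j ≡ i + 2 * suc j
  weight = solve-∀

⊛-suc : ∀ (f g : Series) n → (f ⊛ g) (suc n) ≡ f 0 * g (suc n) + ((f ∘ suc) ⊛ g) n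
⊛-suc f g n = cong (λ xs → f 0 * g (suc n) + sum xs) (begin
  map (λ i → f i * g (suc n ∸ i)) (applyUpTo suc (suc n))  ≡⟨ map-applyUpTo suc _ (suc n) ⟩
  applyUpTo (λ i → f (suc i) * g (n ∸ i)) (suc n)          ≡⟨ map-applyUpTo (λ i → i) _ (suc n) ⟨
  map (λ i → f (suc i) * g (n ∸ i)) (upTo (suc n))         ∎)

⊛-invOneMinus-suc : ∀ r (f : Series) n →
                    (f ⊛ invOneMinus r) (suc n) ≡ r * (f ⊛ invOneMinus r) n + f (suc n)
⊛-invOneMinus-suc r f zero    = base (f 0) (f 1) r
  where
  base : ∀ a b r → a * (r * 1) + (b * 1 + 0) ≡ r * (a * 1 + 0) + b
  base = solve-∀
⊛-invOneMinus-suc r f (suc n) = begin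
  (f ⊛ G) (suc (suc n))                                    ≡⟨ ⊛-suc f G (suc n) ⟩
  f 0 * (r * r ^ suc n) + ((f ∘ suc) ⊛ G) (suc n)          ≡⟨ cong (f 0 * (r * r ^ suc n) +_) (⊛-invOneMinus-suc r (f ∘ suc) n) ⟩
  f 0 * (r * r ^ suc n) + (r * ((f ∘ suc) ⊛ G) n + f (suc (suc n)))
                                                           ≡⟨ factor (f 0) r (r ^ suc n) (((f ∘ suc) ⊛ G) n) (f (suc (suc n))) ⟩
  r * (f 0 * r ^ suc n + ((f ∘ suc) ⊛ G) n) + f (suc (suc n))
                                                           ≡⟨ cong (λ x → r * x + f (suc (suc n))) (⊛-suc f G n) ⟨
  r * (f ⊛ G) (suc n) + f (suc (suc n))                    ∎
  where
  G = invOneMinus r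
  factor : ∀ a r p s b → a * (r * p) + (r * s + b) ≡ r * (a * p + s) + b
  factor = solve-∀

linear-recurrence⇒⊛invOneMinus : ∀ r (a b : Series) → b 0 ≡ a 0 → (∀ n → b (suc n) ≡ r * b n + a (suc n)) →
                                 ∀ n → b n ≡ (a ⊛ invOneMinus r) n
linear-recurrence⇒⊛invOneMinus r a b b₀ bₛ zero    = trans b₀ (sym (trans (+-identityʳ _) (*-identityʳ _)))
linear-recurrence⇒⊛invOneMinus r a b b₀ bₛ (suc n) = begin
  b (suc n)                            ≡⟨ bₛ n ⟩
  r * b n + a (suc n)                  ≡⟨ cong (λ x → r * x + a (suc n)) (linear-recurrence⇒⊛invOneMinus r a b b₀ bₛ n) ⟩
  r * (a ⊛ G) n + a (suc n)            ≡⟨ ⊛-invOneMinus-suc r a n ⟨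
  (a ⊛ G) (suc n)                      ∎
  where G = invOneMinus r

mainTheorem4 : ((n : ℕ) → Pser 0 n ≡ invOneMinus 1 n)
    × ((k n : ℕ) → Pser (suc k) n ≡ (deriv (Pser k) ⊛ invOneMinus 2) n)
mainTheorem4 =
    (λ n → trans (c2-0 n) (sym (^-zeroˡ n)))
  , (λ k → linear-recurrence⇒⊛invOneMinus 2 (deriv (Pser k)) (Pser (suc k))
             (trans (c2-0-suc k) (sym (*-identityˡ (c2 1 k))))
             (λ n → c2-suc-suc n k))
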